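{- The tape machine $\mathcal T_0$ defined below is constant-delay and Hamiltonian. $\mathcal T_0$ has states $\{\downarrow,\uparrow\}\times\{\mathsf{Even},\mathsf{Odd}\}\cup\{q_{\mathrm i},q_{\mathrm h}\}$, initial state $q_{\mathrm i}$, halting state $q_{\mathrm h}$, and output states $\{q_{\mathrm i},(\downarrow,\mathsf{Even}),(\uparrow,\mathsf{Odd})\}$. Index tape cells $0,\dots,\ell+1$ (cell $0$ holds $\triangleright$, cell $\ell+1$ holds $\triangleleft$), let $h$ be the head position, and write $\overline{\mathsf{Even}}=\mathsf{Odd}$, $\overline{\mathsf{Odd}}=\mathsf{Even}$. Its (macro-)transitions, for $p\in\{\mathsf{Even},\mathsf{Odd}\}$, are: (1) in state $q_{\mathrm i}$, if cell $h-1$ is $\triangleright$, cell $h$ is $0$ and cell $h+1\in\{0,\triangleleft\}$: set cell $h$ to $1$, head stays, go to $(\downarrow,\mathsf{Even})$; (2) in state $(\downarrow,p)$, if cell $h-1\in\{0,1,\triangleright\}$, cell $h$ is $1$ and cell $h+1$ is $0$: set cell $h$ to $0$ and cell $h+1$ to $1$, move head to $h+1$, go to $(\downarrow,\bar p)$; (3) in state $(\downarrow,p)$, if cell $h-1\in\{0,1,\triangleright\}$, cell $h$ is $1$ and cell $h+1$ is $\triangleleft$: no change, go to $(\uparrow,p)$; (4) in state $(\uparrow,p)$, if cell $h-1$ is $0$, cell $h$ is $1$ and cell $h+1\in\{0,\triangleleft\}$: set cell $h-1$ to $1$, head stays, go to $(\downarrow,p)$; (5) in state $(\uparrow,p)$,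 if cell $h-1$ is $1$, cell $h$ is $1$ and cell $h+1\in\{0,\triangleleft\}$: set cell $h$ to $0$, move head to $h-1$, go to $(\uparrow,\bar p)$; (6) in state $(\uparrow,\mathsf{Even})$, if cell $h-1$ is $\triangleright$, cell $h$ is $1$ and cell $h+1\in\{0,\triangleleft\}$: no change, go to $q_{\mathrm h}$. No other transitions are defined (a run reaching an undefined case does not halt).
   Context: Tape machines: a finite set of states with an initial state $q_{\mathrm i}$, halting state $q_{\mathrm h}$ and output states; a single tape $\triangleright w\triangleleft$ with $w\in\{0,1\}^\ell$ and a single head; markers are never overwritten. Transitions here are macro-transitions that read a constant-size window of cells around the head and rewrite them, move the head by at most one cell and change state; each macro-transition counts as one step (it can be simulated by a constant number of ordinary one-cell Turing-machine steps). For length $\ell\ge1$ the run starts in state $q_{\mathrm i}$ with tape $\triangleright0^\ell\triangleleft$ and head on cell $1$ and stops on reaching $q_{\mathrm h}$. Whenever the current state is an output state, the machine produces in unit time the current word $w$ (tape content without markers). Hamiltonian: for every $\ell\ge1$ the run halts and produces each word of $\{0,1\}^\ell$ exactly once. Constant-delay: there is a constant $B$ independent of $\ell$ bounding, for every $\ell$, the number of steps before the first output, between consecutive outputs, and between the last output and halting. -}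

module Defs where

open import Data.Nat using (ℕ; zero; suc; _∸_; _≤_)
open import Data.Bool using (Bool; true; false)
open import Data.Maybe using (Maybe; just; nothing)
open import Data.Vec using (Vec; []; _∷_; replicate)
open import Data.Vec.Properties using (≡-dec)
open import Data.Bool.Properties using () renaming (_≟_ to _≟B_)
open import Data.List using (List; []; _∷_; _++_; [_]; length; filter)
open import Data.Product using (Σ; _×_; _,_; ∃)
open import Data.Unit using (⊤)
open import Relation.Binary.PropositionalEquality using (_≡_)
open import Relation.Nullary.Decidable using (Dec; yes; no)

-- Tapes  ▷ w ◁  with w ∈ {0,1}^ℓ.  Cells are indexed 0,…,ℓ+1:
-- cell 0 = ▷, cells 1..ℓ = the bits of w, cell ℓ+1 = ◁.
-- Reading at any other index (e.g. the cell h-1 when h = 0, or cells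
-- beyond ℓ+1) yields `off`, which matches no transition.

data Sym : Set where
  lm   : Sym
  rm   : Sym
  bit  : Bool → Sym
  off  : Sym

-- read cell (i+1) of the tape, i.e. position i of the word, or ◁
readW : ∀ {ℓ} → Vec Bool ℓ → ℕ → Sym
readW []       zero    = rm
readW []       (suc _) = off
readW (x ∷ xs) zero    = bit x
readW (x ∷ xs) (suc i) = readW xs i

readT : ∀ {ℓ} → Vec Bool ℓ → ℕ → Sym
readT w zero    = lm
readT w (suc i) = readW w i

-- read cell h-1 (off if h = 0)
readL : ∀ {ℓ} → Vec Bool ℓ → ℕ → Sym
readL w zero    = off
readL w (suc h) = readT w h

-- write bit b into cell i+1 (markers are never overwritten)
writeW : ∀ {ℓ} → ℕ → Bool → Vec Bool ℓ → Vec Bool ℓ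
writeW i       b []       = []
writeW zero    b (x ∷ xs) = b ∷ xs
writeW (suc i) b (x ∷ xs) = x ∷ writeW i b xs

-- write bit b into tape cell i (no effect on marker cells)
writeT : ∀ {ℓ} → ℕ → Bool → Vec Bool ℓ → Vec Bool ℓ
writeT zero    b w = w
writeT (suc i) b w = writeW i b w

record Config (Q : Set) (ℓ : ℕ) : Set where
  constructor conf
  field
    state : Q
    head  : ℕ
    word  : Vec Bool ℓ

record TapeMachine : Set₁ where
  field
    Q        : Set
    qi       : Q
    qh       : Q
    isOutput : Q → Bool
    isHalt   : Q → Bool      -- decides (state ≡ qh)
    -- one macro-transition; `nothing` = no transition defined
    step     : ∀ {ℓ} → Config Q ℓ → Maybe (Config Q ℓ)

module _ (M : TapeMachine) where
  open TapeMachine M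

  initConf : (ℓ : ℕ) → Config Q ℓ
  initConf ℓ = conf qi 1 (replicate ℓ false)

  -- configuration after n steps (nothing if the run got stuck or
  -- tried to step past the halting state)
  run : ∀ {ℓ} → ℕ → Config Q ℓ → Maybe (Config Q ℓ)
  run zero    c = just c
  run (suc n) c with step c
  ... | nothing = nothing
  ... | just c' = run n c'

  confAt : (ℓ : ℕ) → ℕ → Maybe (Config Q ℓ)
  confAt ℓ t = run t (initConf ℓ)

  HaltsAt : ℕ → ℕ → Set
  HaltsAt ℓ N = ∃ λ c → confAt ℓ N ≡ just c × isHalt (Config.state c) ≡ true



  outputsUpTo : (ℓ : ℕ) → ℕ → List (ℕ × Vec Bool ℓ)
  outputsUpTo ℓ zero    = []
  outputsUpTo ℓ (suc n) with confAt ℓ n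
  ... | nothing = outputsUpTo ℓ n
  ... | just c  with isOutput (Config.state c)
  ...   | true  = outputsUpTo ℓ n ++ [ (n , Config.word c) ]
  ...   | false = outputsUpTo ℓ n

  -- outputs of a run halting at N: those produced at times 0,…,N
  outputs : (ℓ : ℕ) → ℕ → List (ℕ × Vec Bool ℓ)
  outputs ℓ N = outputsUpTo ℓ (suc N)

  countOut : ∀ {ℓ} → Vec Bool ℓ → List (ℕ × Vec Bool ℓ) → ℕ
  countOut w []             = 0
  countOut w ((_ , v) ∷ os) with ≡-dec _≟B_ w v
  ... | yes _ = suc (countOut w os)
  ... | no  _ = countOut w os

  Hamiltonian : Set
  Hamiltonian =
    (ℓ : ℕ) → 1 ≤ ℓ →
      Σ ℕ λ N → HaltsAt ℓ N ×
        ((w : Vec Bool ℓ) → countOut w (outputs ℓ N) ≡ 1)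

  GapsBounded : ℕ → List ℕ → Set
  GapsBounded B []            = ⊤
  GapsBounded B (x ∷ [])      = ⊤
  GapsBounded B (x ∷ y ∷ ts)  = (y ∸ x ≤ B) × GapsBounded B (y ∷ ts)

  outTimes : ∀ {ℓ} → List (ℕ × Vec Bool ℓ) → List ℕ
  outTimes []             = []
  outTimes ((t , _) ∷ os) = t ∷ outTimes os

  ConstantDelay : Set
  ConstantDelay =
    Σ ℕ λ B → (ℓ : ℕ) → 1 ≤ ℓ →
      Σ ℕ λ N → HaltsAt ℓ N ×
        GapsBounded B (0 ∷ outTimes (outputs ℓ N) ++ [ N ])

data Dir : Set where
  down up : Dir

data Par : Set where
  Even Odd : Par

flipP : Par → Par
flipP Even = Odd
flipP Odd  = Even

data Q₀ : Set where
  qi  : Q₀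
  qh  : Q₀
  ⟨_,_⟩ : Dir → Par → Q₀

isOutput₀ : Q₀ → Bool
isOutput₀ qi          = true
isOutput₀ ⟨ down , Even ⟩ = true
isOutput₀ ⟨ up , Odd ⟩    = true
isOutput₀ _           = false

isHalt₀ : Q₀ → Bool
isHalt₀ qh = true
isHalt₀ _  = false

LeftOK : Sym → Bool
LeftOK lm      = true
LeftOK (bit _) = true
LeftOK _       = false

RightZR : Sym → Bool
RightZR (bit false) = true
RightZR rm          = true
RightZR _           = false

step₀ : ∀ {ℓ} → Config Q₀ ℓ → Maybe (Config Q₀ ℓ)
step₀ {ℓ} (conf q h w) = go q (readL w h) (readT w h) (readT w (suc h))
  where
  go : Q₀ → Sym → Sym → Sym → Maybe (Config Q₀ ℓ)
  go qi lm (bit false) r with RightZR r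
  ... | true  = just (conf ⟨ down , Even ⟩ h (writeT h true w))
  ... | false = nothing
  go ⟨ down , p ⟩ l (bit true) (bit false) with LeftOK l
  ... | true  = just (conf ⟨ down , flipP p ⟩ (suc h)
                        (writeT (suc h) true (writeT h false w)))
  ... | false = nothing
  go ⟨ down , p ⟩ l (bit true) rm with LeftOK l
  ... | true  = just (conf ⟨ up , p ⟩ h w)
  ... | false = nothing
  go ⟨ up , p ⟩ (bit false) (bit true) r with RightZR r
  ... | true  = just (conf ⟨ down , p ⟩ h (writeT (h ∸ 1) true w))
  ... | false = nothing
  go ⟨ up , p ⟩ (bit true) (bit true) r with RightZR r
  ... | true  = just (conf ⟨ up , flipP p ⟩ (h ∸ 1) (writeT h false w))
  ... | false = nothing
  go ⟨ up , Even ⟩ lm (bit true) r with RightZR r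
  ... | true  = just (conf qh h w)
  ... | false = nothing
  go _ _ _ _ = nothing

T₀ : TapeMachine
T₀ = record
  { Q = Q₀ ; qi = qi ; qh = qh ; isOutput = isOutput₀ ; isHalt = isHalt₀
  ; step = step₀ }

-- The machine writes a 1 into the first cell and then runs a recursive block procedure.
-- Call a block at position h with parity p and size k the run starting in state (↓,p)
-- with the head on position h and the word ending in 1 0^k from there on. It moves the 1
-- one position right and runs the block of opposite parity at h+1. Then it writes 1 back
-- into position h and runs that block a second time. Finally it clears position h+1 and
-- returns to h in state (↑,p). This takes 2^(k+2) − 3 steps and leaves the tape unchanged.
-- By induction, an Even block outputs, each exactly once, the words that agree with the
-- tape before h and have a 1 at or after h. An Odd block does the same for a 1 strictly
-- after h. So the whole run outputs every nonzero word once, after the initial zero word.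
-- Even blocks begin and end with output configurations and Odd blocks begin and end with
-- silent ones. Since nested blocks alternate parity, there are never two silent steps in a
-- row, so every delay is at most 2.
module Submission where

open import Defs
open import Data.Nat using (ℕ; zero; suc; _+_; _∸_; _≤_; _<_; z≤n; s≤s)
open import Data.Nat.Properties
  using (+-identityʳ; +-suc; +-comm; +-assoc; ≤-refl; ≤-reflexive; ≤-trans; m∸n≤m; n∸n≡0; m<m+n)
open import Data.Nat.ListAction using (sum)
open import Data.Bool using (Bool; true; false; if_then_else_; _∧_; _∨_)
open import Data.Bool.Properties using () renaming (_≟_ to _≟B_)
open import Data.Maybe using (Maybe; just; nothing; maybe′)
open import Data.Vec using (Vec; []; _∷_; replicate)
open import Data.Vec.Properties using (≡-dec)
open import Data.List using (List; []; _∷_; _++_; [_]; concat; foldl; map)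
open import Data.List.Properties using (++-identityʳ; ++-assoc; foldl-++)
open import Data.List.Relation.Binary.Pointwise using (Pointwise-≡⇒≡; []; _∷_)
open import Data.Product using (_×_; _,_)
open import Data.Unit using (tt)
open import Relation.Nullary.Decidable using (Dec; does; yes; no)
open import Relation.Binary.PropositionalEquality
  using (_≡_; refl; sym; trans; cong; subst; module ≡-Reasoning)

_≟V_ : ∀ {n} (v w : Vec Bool n) → Dec (v ≡ w)
_≟V_ = ≡-dec _≟B_

toℕ : Bool → ℕ
toℕ false = 0
toℕ true  = 1

∸-suc-≤ : ∀ {t x i} → t ∸ x ≤ i → suc t ∸ x ≤ suc i
∸-suc-≤ {t}     {zero}  p = s≤s p
∸-suc-≤ {zero}  {suc x} p = ≤-trans (m∸n≤m 0 x) z≤n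
∸-suc-≤ {suc t} {suc x} p = ∸-suc-≤ {t} {x} p

lastOr : ℕ → List ℕ → ℕ
lastOr = foldl (λ _ y → y)

entrySlack exitSlack : Bool → ℕ
entrySlack true  = 2
entrySlack false = 1
exitSlack  true  = 1
exitSlack  false = 2

module _ (M : TapeMachine) where
  open TapeMachine M using (Q; step; isOutput)

  emit : ∀ {ℓ} → Config Q ℓ → ℕ → List (ℕ × Vec Bool ℓ)
  emit c t = if isOutput (Config.state c) then [ (t , Config.word c) ] else []

  emitAt : ∀ {ℓ} → Maybe (Config Q ℓ) → ℕ → List (ℕ × Vec Bool ℓ)
  emitAt c t = maybe′ (λ c → emit c t) [] c

  outputsFrom : ∀ {ℓ} → Config Q ℓ → ℕ → ℕ → List (ℕ × Vec Bool ℓ)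
  outputsFrom c t zero    = []
  outputsFrom c t (suc n) = emit c t ++ maybe′ (λ c′ → outputsFrom c′ (suc t) n) [] (step c)

  run-step : ∀ {ℓ} (c : Config Q ℓ) {c′} n → step c ≡ just c′ → run M (suc n) c ≡ run M n c′
  run-step c n e rewrite e = refl

  run-+ : ∀ {ℓ} (c : Config Q ℓ) {c′} m n → run M m c ≡ just c′ → run M (m + n) c ≡ run M n c′
  run-+ c zero    n refl = refl
  run-+ c (suc m) n e with step c
  ... | just c₁ = run-+ c₁ m n e

  outputsFrom-step : ∀ {ℓ} (c : Config Q ℓ) {c′} t n → step c ≡ just c′ →
                     outputsFrom c t (suc n) ≡ emit c t ++ outputsFrom c′ (suc t) n
  outputsFrom-step c t n e rewrite e = refl

  outputsFrom-1 : ∀ {ℓ} (c : Config Q ℓ) t → outputsFrom c t 1 ≡ emit c t ++ []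
  outputsFrom-1 c t with step c
  ... | nothing = refl
  ... | just _  = refl

  outputsFrom-+ : ∀ {ℓ} (c : Config Q ℓ) {c′} t m n → run M m c ≡ just c′ →
                  outputsFrom c t (m + n) ≡ outputsFrom c t m ++ outputsFrom c′ (m + t) n
  outputsFrom-+ c t zero    n refl = refl
  outputsFrom-+ c t (suc m) n e with step c
  ... | just c₁ rewrite outputsFrom-+ c₁ (suc t) m n e | +-suc m t = sym (++-assoc (emit c t) _ _)

  outputsFrom-snoc : ∀ {ℓ} (c : Config Q ℓ) t n →
                     outputsFrom c t (suc n) ≡ outputsFrom c t n ++ emitAt (run M n c) (t + n)
  outputsFrom-snoc c t zero rewrite +-identityʳ t = trans (outputsFrom-1 c t) (++-identityʳ (emit c t))
  outputsFrom-snoc c t (suc n) with step c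
  ... | nothing = sym (++-identityʳ _)
  ... | just c₁ rewrite outputsFrom-snoc c₁ (suc t) n | +-suc t n = sym (++-assoc (emit c t) _ _)

  outputsUpTo-snoc : ∀ ℓ n → outputsUpTo M ℓ (suc n) ≡ outputsUpTo M ℓ n ++ emitAt (confAt M ℓ n) n
  outputsUpTo-snoc ℓ n with confAt M ℓ n
  ... | nothing = sym (++-identityʳ _)
  ... | just c with isOutput (Config.state c)
  ...   | true  = refl
  ...   | false = sym (++-identityʳ _)

  outputsUpTo≡outputsFrom : ∀ ℓ n → outputsUpTo M ℓ n ≡ outputsFrom (initConf M ℓ) 0 n
  outputsUpTo≡outputsFrom ℓ zero = refl
  outputsUpTo≡outputsFrom ℓ (suc n) rewrite outputsUpTo-snoc ℓ n | outputsUpTo≡outputsFrom ℓ n =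
    sym (outputsFrom-snoc (initConf M ℓ) 0 n)

  countOut-cons : ∀ {ℓ} (v u : Vec Bool ℓ) t os →
                  countOut M v ((t , u) ∷ os) ≡ toℕ (does (v ≟V u)) + countOut M v os
  countOut-cons v u t os with v ≟V u
  ... | yes _ = refl
  ... | no  _ = refl

  countOut-++ : ∀ {ℓ} (v : Vec Bool ℓ) xs ys → countOut M v (xs ++ ys) ≡ countOut M v xs + countOut M v ys
  countOut-++ v []             ys = refl
  countOut-++ v ((t , u) ∷ xs) ys with v ≟V u
  ... | yes _ = cong suc (countOut-++ v xs ys)
  ... | no  _ = countOut-++ v xs ys

  countOut-concat : ∀ {ℓ} (v : Vec Bool ℓ) xss → countOut M v (concat xss) ≡ sum (map (countOut M v) xss)
  countOut-concat v []         = refl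
  countOut-concat v (xs ∷ xss) =
    trans (countOut-++ v xs (concat xss)) (cong (countOut M v xs +_) (countOut-concat v xss))

  countOut-emit : ∀ {ℓ} (v : Vec Bool ℓ) (c : Config Q ℓ) t →
                  countOut M v (emit c t) ≡ toℕ (isOutput (Config.state c) ∧ does (v ≟V Config.word c))
  countOut-emit v c t with isOutput (Config.state c)
  ... | true  = trans (countOut-cons v (Config.word c) t []) (+-identityʳ _)
  ... | false = refl

  outTimes-++ : ∀ {ℓ} (xs ys : List (ℕ × Vec Bool ℓ)) → outTimes M (xs ++ ys) ≡ outTimes M xs ++ outTimes M ys
  outTimes-++ []             ys = refl
  outTimes-++ ((t , _) ∷ xs) ys = cong (t ∷_) (outTimes-++ xs ys)

  GapsBounded-++ : ∀ {B} x ts us → GapsBounded M B (x ∷ ts) → GapsBounded M B (lastOr x ts ∷ us) →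
                   GapsBounded M B (x ∷ ts ++ us)
  GapsBounded-++ x []       us _       g = g
  GapsBounded-++ x (y ∷ ts) us (d , g) h = d , GapsBounded-++ y ts us g h

  -- os are the outputs of the time steps s, …, e − 1: if the previous output happened at
  -- most i steps before s, then all gaps up to the last output of os are at most B, and
  -- that last output (or the previous one, if os is empty) is at most o steps before e.
  record Delay {ℓ} (B s i : ℕ) (os : List (ℕ × Vec Bool ℓ)) (e o : ℕ) : Set where
    constructor delay
    field
      spaced : ∀ x → s ∸ x ≤ i → GapsBounded M B (x ∷ outTimes M os) × e ∸ lastOr x (outTimes M os) ≤ o

  delay-[] : ∀ {ℓ B e i} → Delay {ℓ} B e i [] e i
  delay-[] = delay λ x p → tt , p

  delay-++ : ∀ {ℓ B s i m j e o} {os us : List (ℕ × Vec Bool ℓ)} →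
             Delay B s i os m j → Delay B m j us e o → Delay B s i (os ++ us) e o
  delay-++ {ℓ} {B} {s} {i} {m} {j} {e} {o} {os} {us} (delay d) (delay d′) = delay spaced
    where
    spaced : ∀ x → s ∸ x ≤ i →
             GapsBounded M B (x ∷ outTimes M (os ++ us)) × e ∸ lastOr x (outTimes M (os ++ us)) ≤ o
    spaced x p rewrite outTimes-++ os us | foldl-++ (λ _ y → y) x (outTimes M os) (outTimes M us)
      with d x p
    ... | g , q with d′ (lastOr x (outTimes M os)) q
    ...   | g′ , q′ = GapsBounded-++ x (outTimes M os) (outTimes M us) g g′ , q′

  delay-≤ : ∀ {ℓ B s i i′ e o} {os : List (ℕ × Vec Bool ℓ)} →
            i′ ≤ i → Delay B s i os e o → Delay B s i′ os e o
  delay-≤ i′≤i (delay d) = delay λ x p → d x (≤-trans p i′≤i)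

  delay⇒GapsBounded : ∀ {ℓ B s i e o} {os : List (ℕ × Vec Bool ℓ)} → Delay B s i os e o → o ≤ B →
                      GapsBounded M B (s ∷ outTimes M os ++ [ e ])
  delay⇒GapsBounded {s = s} {os = os} (delay d) o≤B with d s (≤-trans (≤-reflexive (n∸n≡0 s)) z≤n)
  ... | g , q = GapsBounded-++ s (outTimes M os) [ _ ] g (≤-trans q o≤B , tt)

  delay-emit : ∀ {ℓ} (c : Config Q ℓ) t →
               Delay 2 t (entrySlack (isOutput (Config.state c))) (emit c t)
                     (suc t) (exitSlack (isOutput (Config.state c)))
  delay-emit c t with isOutput (Config.state c)
  ... | true  = delay λ x p → (p , tt) , ∸-suc-≤ {t} {t} (≤-reflexive (n∸n≡0 t))
  ... | false = delay λ x p → tt , ∸-suc-≤ {t} {x} p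

overwrite : ∀ {m ℓ} → ℕ → Vec Bool m → Vec Bool ℓ → Vec Bool ℓ
overwrite zero    []      w       = w
overwrite zero    (b ∷ s) []      = []
overwrite zero    (b ∷ s) (_ ∷ w) = b ∷ overwrite zero s w
overwrite (suc h) s       []      = []
overwrite (suc h) s       (x ∷ w) = x ∷ overwrite h s w

overwrite-all : ∀ {m} (s w : Vec Bool m) → overwrite 0 s w ≡ s
overwrite-all []      []      = refl
overwrite-all (b ∷ s) (_ ∷ w) = cong (b ∷_) (overwrite-all s w)

overwrite-writeW : ∀ {m ℓ} h b (s : Vec Bool m) (w : Vec Bool ℓ) →
                   overwrite (suc h) s (writeW h b w) ≡ overwrite h (b ∷ s) w
overwrite-writeW zero    b s []      = refl
overwrite-writeW zero    b s (_ ∷ w) = refl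
overwrite-writeW (suc h) b s []      = refl
overwrite-writeW (suc h) b s (x ∷ w) = cong (x ∷_) (overwrite-writeW h b s w)

writeW-overwrite : ∀ {m ℓ} h b c (s : Vec Bool m) (w : Vec Bool ℓ) →
                   writeW h b (overwrite h (c ∷ s) w) ≡ overwrite h (b ∷ s) w
writeW-overwrite zero    b c s []      = refl
writeW-overwrite zero    b c s (_ ∷ w) = refl
writeW-overwrite (suc h) b c s []      = refl
writeW-overwrite (suc h) b c s (x ∷ w) = cong (x ∷_) (writeW-overwrite h b c s w)

writeW-overwrite₁ : ∀ {m ℓ} h b c d (s : Vec Bool m) (w : Vec Bool ℓ) →
                    writeW (suc h) b (overwrite h (c ∷ d ∷ s) w) ≡ overwrite h (c ∷ b ∷ s) w
writeW-overwrite₁ h b c d s w = begin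
  writeW (suc h) b (overwrite h (c ∷ d ∷ s) w)
    ≡⟨ cong (writeW (suc h) b) (overwrite-writeW h c (d ∷ s) w) ⟨
  writeW (suc h) b (overwrite (suc h) (d ∷ s) (writeW h c w))
    ≡⟨ writeW-overwrite (suc h) b d s (writeW h c w) ⟩
  overwrite (suc h) (b ∷ s) (writeW h c w)
    ≡⟨ overwrite-writeW h c (b ∷ s) w ⟩
  overwrite h (c ∷ b ∷ s) w ∎
  where open ≡-Reasoning

readW-overwrite : ∀ {m ℓ} h (s : Vec Bool m) (w : Vec Bool ℓ) → h + m ≡ ℓ →
                  ∀ i → readW (overwrite h s w) (i + h) ≡ readW s i
readW-overwrite h s w fit i rewrite +-comm i h = go h s w fit i
  where
  go : ∀ {m ℓ} h (s : Vec Bool m) (w : Vec Bool ℓ) → h + m ≡ ℓ →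
       ∀ i → readW (overwrite h s w) (h + i) ≡ readW s i
  go zero    []      []      refl i       = refl
  go zero    (b ∷ s) (_ ∷ w) refl zero    = refl
  go zero    (b ∷ s) (_ ∷ w) refl (suc i) = go zero s w refl i
  go (suc h) s       (_ ∷ w) refl i       = go h s w refl i

LeftOK-readT : ∀ {ℓ} (w : Vec Bool ℓ) h → h < ℓ → LeftOK (readT w h) ≡ true
LeftOK-readT w       zero          _         = refl
LeftOK-readT (_ ∷ w) (suc zero)    _         = refl
LeftOK-readT (_ ∷ w) (suc (suc h)) (s≤s h<ℓ) = LeftOK-readT w (suc h) h<ℓ

RightZR-zeros : ∀ k → RightZR (readW (replicate k false) 0) ≡ true
RightZR-zeros zero    = refl
RightZR-zeros (suc k) = refl

module _ {ℓ : ℕ} where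

  transition₁ : (w : Vec Bool ℓ) → readW w 0 ≡ bit false → RightZR (readW w 1) ≡ true →
                step₀ (conf qi 1 w) ≡ just (conf ⟨ down , Even ⟩ 1 (writeW 0 true w))
  transition₁ w c r rewrite c | r = refl

  transition₂ : ∀ p h (w : Vec Bool ℓ) →
                LeftOK (readT w h) ≡ true → readW w h ≡ bit true → readW w (suc h) ≡ bit false →
                step₀ (conf ⟨ down , p ⟩ (suc h) w)
                  ≡ just (conf ⟨ down , flipP p ⟩ (suc (suc h)) (writeW (suc h) true (writeW h false w)))
  transition₂ p h w l c r rewrite c | r | l = refl

  transition₃ : ∀ p h (w : Vec Bool ℓ) →
                LeftOK (readT w h) ≡ true → readW w h ≡ bit true → readW w (suc h) ≡ rm →
                step₀ (conf ⟨ down , p ⟩ (suc h) w) ≡ just (conf ⟨ up , p ⟩ (suc h) w)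
  transition₃ p h w l c r rewrite c | r | l = refl

  transition₄ : ∀ p h (w : Vec Bool ℓ) →
                readW w h ≡ bit false → readW w (suc h) ≡ bit true → RightZR (readW w (suc (suc h))) ≡ true →
                step₀ (conf ⟨ up , p ⟩ (suc (suc h)) w)
                  ≡ just (conf ⟨ down , p ⟩ (suc (suc h)) (writeW h true w))
  transition₄ p h w l c r rewrite l | c | r = refl

  transition₅ : ∀ p h (w : Vec Bool ℓ) →
                readW w h ≡ bit true → readW w (suc h) ≡ bit true → RightZR (readW w (suc (suc h))) ≡ true →
                step₀ (conf ⟨ up , p ⟩ (suc (suc h)) w)
                  ≡ just (conf ⟨ up , flipP p ⟩ (suc h) (writeW (suc h) false w))
  transition₅ p h w l c r rewrite l | c | r = refl

  transition₆ : (w : Vec Bool ℓ) → readW w 0 ≡ bit true → RightZR (readW w 1) ≡ true →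
                step₀ (conf ⟨ up , Even ⟩ 1 w) ≡ just (conf qh 1 w)
  transition₆ w c r rewrite c | r = refl

oneZeros : ∀ k → Vec Bool (suc k)
oneZeros k = true ∷ replicate k false

-- Word positions are tape cells shifted by one: the head is on cell h + 1, which is
-- position h of the word, and positions h, h + 1, … hold 1 0^k.
downAt upAt : ∀ {ℓ} → Par → ℕ → ∀ k → Vec Bool ℓ → Config Q₀ ℓ
downAt p h k w = conf ⟨ down , p ⟩ (suc h) (overwrite h (oneZeros k) w)
upAt   p h k w = conf ⟨ up   , p ⟩ (suc h) (overwrite h (oneZeros k) w)

fit⇒< : ∀ {ℓ} h k → h + suc k ≡ ℓ → h < ℓ
fit⇒< h k fit = subst (h <_) fit (m<m+n h (s≤s z≤n))

fit-suc : ∀ {ℓ} h k → h + suc (suc k) ≡ ℓ → suc h + suc k ≡ ℓ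
fit-suc h k fit = trans (sym (+-suc h (suc k))) fit

module _ {ℓ : ℕ} (p : Par) (h : ℕ) (w : Vec Bool ℓ) where

  downAt-turn : h + 1 ≡ ℓ → step₀ (downAt p h 0 w) ≡ just (upAt p h 0 w)
  downAt-turn fit = transition₃ p h (overwrite h (oneZeros 0) w) (LeftOK-readT _ h (fit⇒< h 0 fit))
                                (readW-overwrite h _ w fit 0) (readW-overwrite h _ w fit 1)

  module _ {k : ℕ} (fit : h + suc (suc k) ≡ ℓ) where
    private
      read : ∀ {s : Vec Bool (suc (suc k))} i → readW (overwrite h s w) (i + h) ≡ readW s i
      read i = readW-overwrite h _ w fit i

    downAt-shift : step₀ (downAt p h (suc k) w) ≡ just (downAt (flipP p) (suc h) k (writeW h false w))
    downAt-shift rewrite overwrite-writeW h false (oneZeros k) w =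
      trans (transition₂ p h _ (LeftOK-readT _ h (fit⇒< h (suc k) fit)) (read 0) (read 1))
            (cong (λ v → just (conf ⟨ down , flipP p ⟩ (suc (suc h)) v))
                  (trans (cong (writeW (suc h) true) (writeW-overwrite h false true _ w))
                         (writeW-overwrite₁ h true false false _ w)))

    upAt-set : step₀ (upAt p (suc h) k (writeW h false w)) ≡ just (downAt p (suc h) k (writeW h true w))
    upAt-set rewrite overwrite-writeW h false (oneZeros k) w | overwrite-writeW h true (oneZeros k) w =
      trans (transition₄ p h _ (read 0) (read 1) (trans (cong RightZR (read 2)) (RightZR-zeros k)))
            (cong (λ v → just (conf ⟨ down , p ⟩ (suc (suc h)) v)) (writeW-overwrite h true false _ w))

    upAt-back : step₀ (upAt p (suc h) k (writeW h true w)) ≡ just (upAt (flipP p) h (suc k) w)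
    upAt-back rewrite overwrite-writeW h true (oneZeros k) w =
      trans (transition₅ p h _ (read 0) (read 1) (trans (cong RightZR (read 2)) (RightZR-zeros k)))
            (cong (λ v → just (conf ⟨ up , flipP p ⟩ (suc h) v)) (writeW-overwrite₁ h false true true _ w))

flipP-involutive : ∀ p → flipP (flipP p) ≡ p
flipP-involutive Even = refl
flipP-involutive Odd  = refl

blockTime : ℕ → ℕ
blockTime zero    = 1
blockTime (suc k) = suc (blockTime k + suc (blockTime k + 1))

blockTime-suc-+ : ∀ k t → blockTime (suc k) + t ≡ suc (blockTime k + suc (blockTime k + suc t))
blockTime-suc-+ k t = cong suc (trans (+-assoc T (suc (T + 1)) t) (cong (λ n → T + suc n) (+-assoc T 1 t)))
  where
  T : ℕ
  T = blockTime k

module SubBlocks {ℓ} (k : ℕ) (p : Par) (h : ℕ) (w : Vec Bool ℓ) where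
  T : ℕ
  T = blockTime k

  p′ : Par
  p′ = flipP p

  w₀ w₁ : Vec Bool ℓ
  w₀ = writeW h false w
  w₁ = writeW h true w

  D₀ U₀ D₁ U₁ : Config Q₀ ℓ
  D₀ = downAt p′ (suc h) k w₀
  U₀ = upAt   p′ (suc h) k w₀
  D₁ = downAt p′ (suc h) k w₁
  U₁ = upAt   p′ (suc h) k w₁

block-run : ∀ {ℓ} k p h (w : Vec Bool ℓ) → h + suc k ≡ ℓ →
            run T₀ (blockTime k) (downAt p h k w) ≡ just (upAt p h k w)
block-run zero    p h w fit = run-step T₀ (downAt p h 0 w) 0 (downAt-turn p h w fit)
block-run (suc k) p h w fit = begin
  run T₀ (suc (T + suc (T + 1))) (downAt p h (suc k) w)
                                     ≡⟨ run-step T₀ (downAt p h (suc k) w) _ (downAt-shift p h w fit) ⟩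
  run T₀ (T + suc (T + 1)) D₀        ≡⟨ run-+ T₀ D₀ T _ (block-run k p′ (suc h) w₀ (fit-suc h k fit)) ⟩
  run T₀ (suc (T + 1)) U₀            ≡⟨ run-step T₀ U₀ _ (upAt-set p′ h w fit) ⟩
  run T₀ (T + 1) D₁                  ≡⟨ run-+ T₀ D₁ T 1 (block-run k p′ (suc h) w₁ (fit-suc h k fit)) ⟩
  run T₀ 1 U₁                        ≡⟨ run-step T₀ U₁ 0 (upAt-back p′ h w fit) ⟩
  just (upAt (flipP p′) h (suc k) w) ≡⟨ cong (λ q → just (upAt q h (suc k) w)) (flipP-involutive p) ⟩
  just (upAt p h (suc k) w)          ∎
  where
  open ≡-Reasoning
  open SubBlocks k p h w

blockSegments : ∀ {ℓ} k → Par → ℕ → Vec Bool ℓ → ℕ → List (List (ℕ × Vec Bool ℓ))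
blockSegments k p h w t =
    emit T₀ (downAt p h (suc k) w) t
  ∷ outputsFrom T₀ D₀ (suc t) T
  ∷ emit T₀ U₀ (T + suc t)
  ∷ outputsFrom T₀ D₁ (suc (T + suc t)) T
  ∷ emit T₀ U₁ (T + suc (T + suc t))
  ∷ []
  where open SubBlocks k p h w

block-outputs : ∀ {ℓ} k p h (w : Vec Bool ℓ) t → h + suc (suc k) ≡ ℓ →
  outputsFrom T₀ (downAt p h (suc k) w) t (blockTime (suc k)) ≡ concat (blockSegments k p h w t)
block-outputs {ℓ} k p h w t fit =
  trans (outputsFrom-step T₀ D t (T + suc (T + 1)) (downAt-shift p h w fit))
  (cong (emit T₀ D t ++_)
  (trans (outputsFrom-+ T₀ D₀ (suc t) T (suc (T + 1)) (block-run k p′ (suc h) w₀ (fit-suc h k fit)))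
  (cong (outputsFrom T₀ D₀ (suc t) T ++_)
  (trans (outputsFrom-step T₀ U₀ (T + suc t) (T + 1) (upAt-set p′ h w fit))
  (cong (emit T₀ U₀ (T + suc t) ++_)
  (trans (outputsFrom-+ T₀ D₁ (suc (T + suc t)) T 1 (block-run k p′ (suc h) w₁ (fit-suc h k fit)))
  (cong (outputsFrom T₀ D₁ (suc (T + suc t)) T ++_)
  (outputsFrom-1 T₀ U₁ (T + suc (T + suc t))))))))))
  where
  open SubBlocks k p h w
  D : Config Q₀ ℓ
  D = downAt p h (suc k) w

nonzero : ∀ {n} → Vec Bool n → Bool
nonzero []      = false
nonzero (a ∷ v) = a ∨ nonzero v

nonzero-or-zeros : ∀ {n} (v : Vec Bool n) → toℕ (nonzero v) + toℕ (does (v ≟V replicate n false)) ≡ 1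
nonzero-or-zeros []          = refl
nonzero-or-zeros (true  ∷ v) = refl
nonzero-or-zeros (false ∷ v) = nonzero-or-zeros v

suffixListed : ∀ {n} → Par → Vec Bool n → Bool
suffixListed Even v       = nonzero v
suffixListed Odd  []      = false
suffixListed Odd  (_ ∷ v) = nonzero v

-- v agrees with w before position h and has a 1 at a position ≥ h (Even) or > h (Odd).
listed : ∀ {n} → Par → ℕ → Vec Bool n → Vec Bool n → Bool
listed p zero    w       v       = suffixListed p v
listed p (suc h) []      []      = false
listed p (suc h) (x ∷ w) (a ∷ v) = does (a ≟B x) ∧ listed p h w v

listed-last : ∀ {ℓ} p h (w v : Vec Bool ℓ) → h + 1 ≡ ℓ →
              isOutput₀ ⟨ down , p ⟩ ∧ does (v ≟V overwrite h (oneZeros 0) w) ≡ listed p h w v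
listed-last Even zero    (_ ∷ [])    (true  ∷ []) refl = refl
listed-last Even zero    (_ ∷ [])    (false ∷ []) refl = refl
listed-last Odd  zero    (_ ∷ [])    (_     ∷ []) refl = refl
listed-last p    (suc h) (true  ∷ w) (true  ∷ v) refl = listed-last p h w v refl
listed-last p    (suc h) (false ∷ w) (false ∷ v) refl = listed-last p h w v refl
listed-last Even (suc h) (true  ∷ w) (false ∷ v) refl = refl
listed-last Even (suc h) (false ∷ w) (true  ∷ v) refl = refl
listed-last Odd  (suc h) (true  ∷ w) (false ∷ v) refl = refl
listed-last Odd  (suc h) (false ∷ w) (true  ∷ v) refl = refl

listed-split : ∀ {ℓ} p h k (w v : Vec Bool ℓ) → h + suc (suc k) ≡ ℓ →
  let open SubBlocks k p h w in
  sum (map toℕ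
    ( isOutput₀ ⟨ down , p ⟩ ∧ does (v ≟V overwrite h (oneZeros (suc k)) w)
    ∷ listed p′ (suc h) w₀ v
    ∷ isOutput₀ ⟨ up , p′ ⟩ ∧ does (v ≟V overwrite (suc h) (oneZeros k) w₀)
    ∷ listed p′ (suc h) w₁ v
    ∷ isOutput₀ ⟨ up , p′ ⟩ ∧ does (v ≟V overwrite (suc h) (oneZeros k) w₁)
    ∷ []))
  ≡ toℕ (listed p h w v)
listed-split Even zero k (_ ∷ _ ∷ w) (false ∷ false ∷ v) refl = +-identityʳ _
listed-split Even zero k (_ ∷ _ ∷ w) (false ∷ true  ∷ v) refl
  rewrite overwrite-all (replicate k false) w | +-identityʳ (toℕ (does (v ≟V replicate k false)))
  = nonzero-or-zeros v
listed-split Even zero k (_ ∷ _ ∷ w) (true  ∷ false ∷ v) refl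
  rewrite overwrite-all (replicate k false) w | +-identityʳ (toℕ (nonzero v))
  = trans (+-comm _ (toℕ (nonzero v))) (nonzero-or-zeros v)
listed-split Even zero k (_ ∷ _ ∷ w) (true  ∷ true  ∷ v) refl
  rewrite overwrite-all (replicate k false) w | +-identityʳ (toℕ (does (v ≟V replicate k false)))
  = nonzero-or-zeros v
listed-split Odd  zero k (_ ∷ _ ∷ w) (false ∷ v) refl = +-identityʳ _
listed-split Odd  zero k (_ ∷ _ ∷ w) (true  ∷ v) refl = +-identityʳ _
listed-split p    (suc h) k (true  ∷ w) (true  ∷ v) refl = listed-split p h k w v refl
listed-split p    (suc h) k (false ∷ w) (false ∷ v) refl = listed-split p h k w v refl
listed-split Even (suc h) k (true  ∷ w) (false ∷ v) refl = refl
listed-split Even (suc h) k (false ∷ w) (true  ∷ v) refl = refl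
listed-split Odd  (suc h) k (true  ∷ w) (false ∷ v) refl = refl
listed-split Odd  (suc h) k (false ∷ w) (true  ∷ v) refl = refl

block-count : ∀ {ℓ} k p h (w : Vec Bool ℓ) → h + suc k ≡ ℓ → ∀ v t →
              countOut T₀ v (outputsFrom T₀ (downAt p h k w) t (blockTime k)) ≡ toℕ (listed p h w v)
block-count zero p h w fit v t = begin
  countOut T₀ v (outputsFrom T₀ (downAt p h 0 w) t 1)
    ≡⟨ cong (countOut T₀ v) (trans (outputsFrom-1 T₀ (downAt p h 0 w) t) (++-identityʳ _)) ⟩
  countOut T₀ v (emit T₀ (downAt p h 0 w) t)
    ≡⟨ countOut-emit T₀ v (downAt p h 0 w) t ⟩
  toℕ (isOutput₀ ⟨ down , p ⟩ ∧ does (v ≟V overwrite h (oneZeros 0) w))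
    ≡⟨ cong toℕ (listed-last p h w v fit) ⟩
  toℕ (listed p h w v) ∎
  where open ≡-Reasoning
block-count (suc k) p h w fit v t = begin
  countOut T₀ v (outputsFrom T₀ (downAt p h (suc k) w) t (blockTime (suc k)))
    ≡⟨ cong (countOut T₀ v) (block-outputs k p h w t fit) ⟩
  countOut T₀ v (concat (blockSegments k p h w t))
    ≡⟨ countOut-concat T₀ v (blockSegments k p h w t) ⟩
  sum (map (countOut T₀ v) (blockSegments k p h w t))
    ≡⟨ trans (cong sum (Pointwise-≡⇒≡
               ( countOut-emit T₀ v (downAt p h (suc k) w) t
               ∷ block-count k p′ (suc h) w₀ (fit-suc h k fit) v (suc t)
               ∷ countOut-emit T₀ v U₀ (T + suc t)
               ∷ block-count k p′ (suc h) w₁ (fit-suc h k fit) v (suc (T + suc t))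
               ∷ countOut-emit T₀ v U₁ (T + suc (T + suc t))
               ∷ [])))
             (listed-split p h k w v fit) ⟩
  toℕ (listed p h w v) ∎
  where
  open ≡-Reasoning
  open SubBlocks k p h w

block-delay : ∀ {ℓ} k p h (w : Vec Bool ℓ) → h + suc k ≡ ℓ → ∀ t →
  Delay T₀ 2 t (entrySlack (isOutput₀ ⟨ down , p ⟩)) (outputsFrom T₀ (downAt p h k w) t (blockTime k))
        (blockTime k + t) (exitSlack (isOutput₀ ⟨ down , p ⟩))
block-delay zero p h w fit t rewrite outputsFrom-1 T₀ (downAt p h 0 w) t =
  delay-++ T₀ (delay-emit T₀ (downAt p h 0 w) t) (delay-[] T₀)
-- The two parities need separate clauses only so that the slacks of consecutive segments
-- match definitionally.
block-delay (suc k) Even h w fit t rewrite block-outputs k Even h w t fit | blockTime-suc-+ k t =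
  delay-++ T₀ (delay-emit T₀ (downAt Even h (suc k) w) t)
  (delay-++ T₀ (block-delay k p′ (suc h) w₀ (fit-suc h k fit) (suc t))
  (delay-++ T₀ (delay-emit T₀ U₀ (T + suc t))
  (delay-++ T₀ (block-delay k p′ (suc h) w₁ (fit-suc h k fit) (suc (T + suc t)))
  (delay-++ T₀ (delay-emit T₀ U₁ (T + suc (T + suc t))) (delay-[] T₀)))))
  where open SubBlocks k Even h w
block-delay (suc k) Odd h w fit t rewrite block-outputs k Odd h w t fit | blockTime-suc-+ k t =
  delay-++ T₀ (delay-emit T₀ (downAt Odd h (suc k) w) t)
  (delay-++ T₀ (block-delay k p′ (suc h) w₀ (fit-suc h k fit) (suc t))
  (delay-++ T₀ (delay-emit T₀ U₀ (T + suc t))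
  (delay-++ T₀ (block-delay k p′ (suc h) w₁ (fit-suc h k fit) (suc (T + suc t)))
  (delay-++ T₀ (delay-emit T₀ U₁ (T + suc (T + suc t))) (delay-[] T₀)))))
  where open SubBlocks k Odd h w

step-init : ∀ ℓ′ → step₀ (initConf T₀ (suc ℓ′)) ≡ just (downAt Even 0 ℓ′ (replicate (suc ℓ′) false))
step-init ℓ′ =
  trans (transition₁ zeros refl (RightZR-zeros ℓ′))
        (cong (λ v → just (conf ⟨ down , Even ⟩ 1 v)) (sym (overwrite-all (oneZeros ℓ′) zeros)))
  where
  zeros : Vec Bool (suc ℓ′)
  zeros = replicate (suc ℓ′) false

step-halt : ∀ ℓ′ (w : Vec Bool (suc ℓ′)) →
            step₀ (upAt Even 0 ℓ′ w) ≡ just (conf qh 1 (overwrite 0 (oneZeros ℓ′) w))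
step-halt ℓ′ w = transition₆ (overwrite 0 (oneZeros ℓ′) w) (readW-overwrite 0 (oneZeros ℓ′) w refl 0)
                   (trans (cong RightZR (readW-overwrite 0 (oneZeros ℓ′) w refl 1)) (RightZR-zeros ℓ′))

module _ (ℓ′ : ℕ) where
  private
    ℓ T : ℕ
    ℓ = suc ℓ′
    T = blockTime ℓ′

    zeros : Vec Bool ℓ
    zeros = replicate ℓ false

    I D U : Config Q₀ ℓ
    I = initConf T₀ ℓ
    D = downAt Even 0 ℓ′ zeros
    U = upAt Even 0 ℓ′ zeros

  haltTime : ℕ
  haltTime = suc (T + 1)

  halts : HaltsAt T₀ ℓ haltTime
  halts = _ , run-halts , refl
    where
    open ≡-Reasoning
    run-halts : confAt T₀ ℓ haltTime ≡ just (conf qh 1 (overwrite 0 (oneZeros ℓ′) zeros))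
    run-halts = begin
      run T₀ (suc (T + 1)) I ≡⟨ run-step T₀ I (T + 1) (step-init ℓ′) ⟩
      run T₀ (T + 1) D       ≡⟨ run-+ T₀ D T 1 (block-run ℓ′ Even 0 zeros refl) ⟩
      run T₀ 1 U             ≡⟨ run-step T₀ U 0 (step-halt ℓ′ zeros) ⟩
      just (conf qh 1 (overwrite 0 (oneZeros ℓ′) zeros)) ∎

  outputs-run : outputs T₀ ℓ haltTime ≡ emit T₀ I 0 ++ (outputsFrom T₀ D 1 T ++ emit T₀ U (T + 1))
  outputs-run = begin
    outputs T₀ ℓ haltTime
      ≡⟨ outputsUpTo≡outputsFrom T₀ ℓ (suc haltTime) ⟩
    outputsFrom T₀ I 0 (suc (suc (T + 1)))
      ≡⟨ outputsFrom-step T₀ I 0 (suc (T + 1)) (step-init ℓ′) ⟩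
    emit T₀ I 0 ++ outputsFrom T₀ D 1 (suc (T + 1))
      ≡⟨ cong (λ n → emit T₀ I 0 ++ outputsFrom T₀ D 1 n) (sym (+-suc T 1)) ⟩
    emit T₀ I 0 ++ outputsFrom T₀ D 1 (T + 2)
      ≡⟨ cong (emit T₀ I 0 ++_) (outputsFrom-+ T₀ D 1 T 2 (block-run ℓ′ Even 0 zeros refl)) ⟩
    emit T₀ I 0 ++ (outputsFrom T₀ D 1 T ++ outputsFrom T₀ U (T + 1) 2)
      ≡⟨ cong (λ os → emit T₀ I 0 ++ (outputsFrom T₀ D 1 T ++ os))
              (outputsFrom-step T₀ U (T + 1) 1 (step-halt ℓ′ zeros)) ⟩
    emit T₀ I 0 ++ (outputsFrom T₀ D 1 T ++ emit T₀ U (T + 1)) ∎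
    where open ≡-Reasoning

  each-word-once : (v : Vec Bool ℓ) → countOut T₀ v (outputs T₀ ℓ haltTime) ≡ 1
  each-word-once v = begin
    countOut T₀ v (outputs T₀ ℓ haltTime)
      ≡⟨ cong (countOut T₀ v) outputs-run ⟩
    countOut T₀ v ((0 , zeros) ∷ outputsFrom T₀ D 1 T ++ [])
      ≡⟨ countOut-cons T₀ v zeros 0 (outputsFrom T₀ D 1 T ++ []) ⟩
    toℕ (does (v ≟V zeros)) + countOut T₀ v (outputsFrom T₀ D 1 T ++ [])
      ≡⟨ cong (toℕ (does (v ≟V zeros)) +_)
              (trans (cong (countOut T₀ v) (++-identityʳ (outputsFrom T₀ D 1 T)))
                     (block-count ℓ′ Even 0 zeros refl v 1)) ⟩
    toℕ (does (v ≟V zeros)) + toℕ (nonzero v)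
      ≡⟨ +-comm (toℕ (does (v ≟V zeros))) _ ⟩
    toℕ (nonzero v) + toℕ (does (v ≟V zeros))
      ≡⟨ nonzero-or-zeros v ⟩
    1 ∎
    where open ≡-Reasoning

  gaps : GapsBounded T₀ 2 (0 ∷ outTimes T₀ (outputs T₀ ℓ haltTime) ++ [ haltTime ])
  gaps rewrite outputs-run = delay⇒GapsBounded T₀
    (delay-++ T₀ (delay-emit T₀ I 0)
    (delay-++ T₀ (delay-≤ T₀ (s≤s z≤n) (block-delay ℓ′ Even 0 zeros refl 1))
                 (delay-emit T₀ U (T + 1))))
    ≤-refl

proposition3 : ConstantDelay T₀ × Hamiltonian T₀
proposition3 = (2 , λ { (suc ℓ′) _ → haltTime ℓ′ , halts ℓ′ , gaps ℓ′ })
             , λ { (suc ℓ′) _ → haltTime ℓ′ , halts ℓ′ , each-word-once ℓ′ }
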